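{- Let $r\ge3$ be an odd integer and $a=r+3$. The subtraction game $\mathcal{S}(1,a,3a+r)$ is ultimately periodic with period $4a-2$ and nim-sequence $\big((01)^{a/2-1}\,2\big)^3(01)^{a/2}\,2$. Moreover, if $r=3$ then the subtraction set is non-expandable; otherwise the subtraction set has expansion $\{1,a,4a-3,4a-1,5a-2,9a-4\}$ $(=\{1,a,3a+r,3a+r+2,4a+r+1,7a+2r+2\})$.
   Context: For a finite set $S$ of positive integers, the subtraction game $\mathcal{S}(S)$ is played on a single pile: two players alternately remove $s\in S$ coins (at most the pile size); the last mover wins. The nim-value is $\mathcal{G}(n)=\operatorname{mex}\{\mathcal{G}(n-s): s\in S, s\le n\}$. Words of single digits are written by juxtaposition, and $x^m$ denotes $m$-fold repetition of the block $x$. "The game is ultimately periodic with period $p$ and nim-sequence $W$" ($W$ a word of length $p$) means $p$ is the least positive integer with $\mathcal{G}(n+p)=\mathcal{G}(n)$ for all sufficiently large $n$, and there is $n_0\ge0$ such that $\mathcal{G}(n_0+j)$ is the $((j\bmod p)+1)$-st letter of $W$ for all $j\ge0$. The expansion of $S$ is $S^{ex}=\{s\ge1:\mathcal{G}(n+s)\ne\mathcal{G}(n)\ \forall n\ge0\}$; "has expansion $T$" means $S^{ex}=T$. For a set $X$ and $p\ge1$, $X^{*p}=\{x+mp:x\in X,m\ge0\}$. $S$ is non-expandable if $S^{ex}=S$ or $S^{ex}=S^{*p}$, $p$ the period. -}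

module Defs where

open import Data.Nat using (ℕ; zero; suc; _+_; _*_; _∸_; _≤_; _<_; _≟_; _/_)
open import Data.List using (List; []; _∷_; _++_; length)
open import Data.Bool using (Bool; true; false; if_then_else_)
open import Data.Maybe using (Maybe; just; nothing)
open import Data.Product using (Σ; _×_; ∃; ∃-syntax)
open import Data.Sum using (_⊎_)
open import Relation.Nullary using (¬_; does)
open import Relation.Binary.PropositionalEquality using (_≡_; _≢_)
open import Function.Bundles using (_⇔_)
open import Data.List.Membership.Propositional using (_∈_)

elem : ℕ → List ℕ → Bool
elem k [] = false
elem k (x ∷ xs) = if does (k ≟ x) then true else elem k xs

-- mex: least natural number not in the list (it is at most the length of the list,
-- so a search with fuel  length + 1  starting from 0 finds it)
mexAux : ℕ → ℕ → List ℕ → ℕ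
mexAux zero k xs = k
mexAux (suc f) k xs = if elem k xs then mexAux f (suc k) xs else k

mex : List ℕ → ℕ
mex xs = mexAux (suc (length xs)) 0 xs

nth : List ℕ → ℕ → Maybe ℕ
nth [] _ = nothing
nth (x ∷ xs) zero = just x
nth (x ∷ xs) (suc i) = nth xs i

-- options G(n-s) for s ∈ S with 1 ≤ s ≤ n, given prev = [G(n-1), ..., G(0)]
-- (so G(n-s) is at index s-1 of prev)
options : List ℕ → List ℕ → List ℕ
options [] prev = []
options (zero ∷ S) prev = options S prev
options (suc i ∷ S) prev with nth prev i
... | just v = v ∷ options S prev
... | nothing = options S prev

-- values S n = [G(n-1), ..., G(1), G(0)]
values : List ℕ → ℕ → List ℕ
values S zero = []
values S (suc n) = mex (options S (values S n)) ∷ values S n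

grundy : List ℕ → ℕ → ℕ
grundy S n = mex (options S (values S n))

EventuallyPeriodic : (ℕ → ℕ) → ℕ → Set
EventuallyPeriodic G p = ∃[ n₀ ] (∀ n → n₀ ≤ n → G (n + p) ≡ G n)

UltPeriodic : (ℕ → ℕ) → ℕ → List ℕ → Set
UltPeriodic G p W =
  (0 < p) × (length W ≡ p) × EventuallyPeriodic G p ×
  (∀ q → 0 < q → EventuallyPeriodic G q → p ≤ q) ×
  (∃[ n₀ ] (∀ q i → i < p → just (G (n₀ + (q * p + i))) ≡ nth W i))

rep : ℕ → List ℕ → List ℕ
rep zero x = []
rep (suc m) x = x ++ rep m x

word : ℕ → List ℕ
word a = rep 3 (rep (a / 2 ∸ 1) (0 ∷ 1 ∷ []) ++ (2 ∷ [])) ++ rep (a / 2) (0 ∷ 1 ∷ []) ++ (2 ∷ [])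

InExpansion : (ℕ → ℕ) → ℕ → Set
InExpansion G s = (1 ≤ s) × (∀ n → G (n + s) ≢ G n)

HasExpansion : (ℕ → ℕ) → (ℕ → Set) → Set
HasExpansion G T = ∀ s → InExpansion G s ⇔ T s

Star : List ℕ → ℕ → ℕ → Set
Star X p s = ∃[ x ] ∃[ m ] (x ∈ X × s ≡ x + m * p)

NonExpandable : List ℕ → ℕ → Set
NonExpandable S p = HasExpansion (grundy S) (_∈ S) ⊎ HasExpansion (grundy S) (Star S p)

module Submission where

-- Write r = 2k + 5.  The nim-sequence, up to a point past one full period,
-- is a fixed list of single letters and alternating blocks 0101… whose lengths
-- are affine in k.  Every fact the theorem needs says that at each position the
-- letters of a few shifted copies of such symbolic words satisfy a predicate;
-- a sweep through the blocks decides this once and for all k.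

open import Defs
open import Data.Nat using (ℕ; zero; suc; _+_; _*_; _∸_; _≤_; _<_; z≤n; s≤s; _≤ᵇ_; _≡ᵇ_; _<?_; _≟_; _/_; _%_)
open import Data.Nat.Properties
open import Algebra.Properties.CommutativeSemigroup +-commutativeSemigroup
  using (xy∙z≈xz∙y; xy∙z≈zx∙y; x∙yz≈xz∙y; x∙yz≈z∙yx)
open import Data.Nat.DivMod using (m≡m%n+[m/n]*n; m*n/n≡m)
open import Data.Nat.Induction using (<-rec)
open import Data.Nat.Tactic.RingSolver using (solve-∀)
open import Data.Bool using (Bool; true; false; T; not; _∧_; _∨_; if_then_else_)
open import Data.Bool.Properties using (T-∧; T-∨)
open import Data.Bool.ListAction using (all; and; or)
open import Data.Maybe using (Maybe; just; nothing; maybe)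
open import Data.Maybe.Properties using (just-injective)
open import Data.List using (List; []; _∷_; _++_; length; map; zipWith; catMaybes)
open import Data.List.Properties using (length-++; map-++; map-∘; map-cong-local; ++-assoc)
open import Data.List.Membership.Propositional using (_∈_)
open import Data.List.Membership.Propositional.Properties using (∈-++⁺ˡ; ∈-++⁺ʳ; ∈-map⁺; ∈-map⁻)
open import Data.List.Membership.DecPropositional _≟_ using (_∈?_)
open import Data.List.Relation.Unary.All as All using (All; []; _∷_)
open import Data.List.Relation.Unary.All.Properties using (all⁺) renaming (map⁺ to All-map⁺; map⁻ to All-map⁻)
open import Data.List.Relation.Unary.Any using (here; there)
open import Data.Product using (_×_; _,_; proj₁; proj₂; ∃; ∃₂; uncurry)
open import Data.Sum as Sum using (_⊎_; inj₁; inj₂)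
open import Data.Unit using (⊤; tt)
open import Data.Empty using (⊥; ⊥-elim)
open import Function using (_∘_)
open import Function.Bundles using (Equivalence; mk⇔)
open import Relation.Nullary using (yes; no; ¬_)
open import Relation.Nullary.Decidable using (T?)
open import Relation.Binary.PropositionalEquality

open Equivalence using (to)

-- The pair (a , b) stands for the number a·2k + b, where k
-- is the parameter of the family; a sequence whose block lengths are symbolic
-- is a finite object describing one sequence for every k.
SymLen : Set
SymLen = ℕ × ℕ

eval : ℕ → SymLen → ℕ
eval k (a , b) = a * (k + k) + b

infixl 6 _⊕_ _⊖_
infix 4 _≤ˢ_ _==ˢ_

_⊕_ : SymLen → SymLen → SymLen
(a , b) ⊕ (c , d) = a + c , b + d

_⊖_ : SymLen → SymLen → SymLen
(a , b) ⊖ (c , d) = a ∸ c , b ∸ d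

-- Componentwise comparison; it implies the comparison of the values for every k.
_≤ˢ_ : SymLen → SymLen → Bool
(a , b) ≤ˢ (c , d) = (a ≤ᵇ c) ∧ (b ≤ᵇ d)

_==ˢ_ : SymLen → SymLen → Bool
(a , b) ==ˢ (c , d) = (a ≡ᵇ c) ∧ (b ≡ᵇ d)

eval-⊕ : ∀ k x y → eval k (x ⊕ y) ≡ eval k x + eval k y
eval-⊕ k (a , b) (c , d) = distribute a b c d (k + k)
  where
  distribute : ∀ a b c d m → (a + c) * m + (b + d) ≡ (a * m + b) + (c * m + d)
  distribute = solve-∀

≤ˢ-parts : ∀ {a b c d} → T ((a , b) ≤ˢ (c , d)) → a ≤ c × b ≤ d
≤ˢ-parts {a} {b} {c} {d} le with to T-∧ le
... | a≤c , b≤d = ≤ᵇ⇒≤ a c a≤c , ≤ᵇ⇒≤ b d b≤d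

eval-⊖ : ∀ k x y → T (y ≤ˢ x) → eval k y + eval k (x ⊖ y) ≡ eval k x
eval-⊖ k (a , b) (c , d) y≤x with ≤ˢ-parts {c} {d} {a} {b} y≤x
... | c≤a , d≤b = begin
  eval k (c , d) + eval k (a ∸ c , b ∸ d)  ≡⟨ sym (eval-⊕ k (c , d) (a ∸ c , b ∸ d)) ⟩
  eval k (c + (a ∸ c) , d + (b ∸ d))       ≡⟨ cong₂ (λ u v → eval k (u , v)) (m+[n∸m]≡n c≤a) (m+[n∸m]≡n d≤b) ⟩
  eval k (a , b)                           ∎
  where open ≡-Reasoning

eval-mono : ∀ k x y → T (x ≤ˢ y) → eval k x ≤ eval k y
eval-mono k x y x≤y = subst (eval k x ≤_) (eval-⊖ k y x x≤y) (m≤m+n (eval k x) _)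

positive-⊕ : ∀ x y → T ((0 , 1) ≤ˢ y) → T ((0 , 1) ≤ˢ x ⊕ y)
positive-⊕ (a , b) (c , suc d) _ rewrite +-suc b d = _

==ˢ-sound : ∀ x y → T (x ==ˢ y) → x ≡ y
==ˢ-sound (a , b) (c , d) eq with to T-∧ eq
... | a≡c , b≡d = cong₂ _,_ (≡ᵇ⇒≡ a c a≡c) (≡ᵇ⇒≡ b d b≡d)

parity : ℕ → ℕ
parity zero = 0
parity (suc zero) = 1
parity (suc (suc n)) = parity n

parity-even+ : ∀ m y → parity ((m + m) + y) ≡ parity y
parity-even+ zero y = refl
parity-even+ (suc m) y rewrite +-suc m m = parity-even+ m y

parity-+ : ∀ b t → parity (b + t) ≡ parity (b + parity t)
parity-+ b zero = refl
parity-+ b (suc zero) = refl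
parity-+ b (suc (suc t)) rewrite +-suc b (suc t) | +-suc b t = parity-+ b t

parity-eval : ∀ k a b t → parity (eval k (a , b) + t) ≡ parity (b + parity t)
parity-eval k a b t = begin
  parity (a * (k + k) + b + t)          ≡⟨ cong (λ z → parity (z + b + t)) (*-distribˡ-+ a k k) ⟩
  parity ((a * k + a * k) + b + t)      ≡⟨ cong parity (+-assoc (a * k + a * k) b t) ⟩
  parity ((a * k + a * k) + (b + t))    ≡⟨ parity-even+ (a * k) (b + t) ⟩
  parity (b + t)                        ≡⟨ parity-+ b t ⟩
  parity (b + parity t)                 ∎
  where open ≡-Reasoning

parity-cases : ∀ t → parity t ≡ 0 ⊎ parity t ≡ 1
parity-cases zero = inj₁ refl
parity-cases (suc zero) = inj₂ refl
parity-cases (suc (suc t)) = parity-cases t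

nth-++ˡ : ∀ (xs ys : List ℕ) i → i < length xs → nth (xs ++ ys) i ≡ nth xs i
nth-++ˡ (x ∷ xs) ys zero _ = refl
nth-++ˡ (x ∷ xs) ys (suc i) (s≤s i<n) = nth-++ˡ xs ys i i<n

nth-++ʳ : ∀ (xs ys : List ℕ) i → nth (xs ++ ys) (length xs + i) ≡ nth ys i
nth-++ʳ [] ys i = refl
nth-++ʳ (x ∷ xs) ys i = nth-++ʳ xs ys i


nth-defined : ∀ (xs : List ℕ) n → n < length xs → ∃ λ x → nth xs n ≡ just x
nth-defined (x ∷ xs) zero _ = x , refl
nth-defined (x ∷ xs) (suc n) (s≤s n<l) = nth-defined xs n n<l

nth-bound : ∀ (xs : List ℕ) n {x} → nth xs n ≡ just x → n < length xs
nth-bound (y ∷ xs) zero _ = s≤s z≤n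
nth-bound (y ∷ xs) (suc n) e = s≤s (nth-bound xs n e)

data Block : Set where
  letter : ℕ → Block
  alt    : SymLen → Block

alternating : ℕ → ℕ → List ℕ
alternating i zero = []
alternating i (suc n) = parity i ∷ alternating (suc i) n

decode : ℕ → List Block → List ℕ
decode k [] = []
decode k (letter v ∷ bs) = v ∷ decode k bs
decode k (alt l ∷ bs) = alternating 0 (eval k l) ++ decode k bs

blocksLength : List Block → SymLen
blocksLength [] = 0 , 0
blocksLength (letter _ ∷ bs) = (0 , 1) ⊕ blocksLength bs
blocksLength (alt l ∷ bs) = l ⊕ blocksLength bs

length-alternating : ∀ i n → length (alternating i n) ≡ n
length-alternating i zero = refl
length-alternating i (suc n) = cong suc (length-alternating (suc i) n)

nth-alternating : ∀ i n t → t < n → nth (alternating i n) t ≡ just (parity (i + t))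
nth-alternating i (suc n) zero _ = cong (λ z → just (parity z)) (sym (+-identityʳ i))
nth-alternating i (suc n) (suc t) (s≤s t<n) =
  trans (nth-alternating (suc i) n t t<n) (cong (λ z → just (parity z)) (sym (+-suc i t)))

length-decode : ∀ k bs → length (decode k bs) ≡ eval k (blocksLength bs)
length-decode k [] = refl
length-decode k (letter v ∷ bs) =
  trans (cong suc (length-decode k bs)) (sym (eval-⊕ k (0 , 1) (blocksLength bs)))
length-decode k (alt l ∷ bs) = begin
  length (alternating 0 (eval k l) ++ decode k bs)             ≡⟨ length-++ (alternating 0 (eval k l)) ⟩
  length (alternating 0 (eval k l)) + length (decode k bs)     ≡⟨ cong₂ _+_ (length-alternating 0 (eval k l)) (length-decode k bs) ⟩
  eval k l + eval k (blocksLength bs)                          ≡⟨ sym (eval-⊕ k l (blocksLength bs)) ⟩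
  eval k (l ⊕ blocksLength bs)                                 ∎
  where open ≡-Reasoning

nth-alt-inside : ∀ k l bs x → x < eval k l → nth (decode k (alt l ∷ bs)) x ≡ just (parity x)
nth-alt-inside k l bs x x<l =
  trans (nth-++ˡ (alternating 0 (eval k l)) (decode k bs) x (subst (x <_) (sym (length-alternating 0 (eval k l))) x<l))
        (nth-alternating 0 (eval k l) x x<l)

nth-alt-after : ∀ k l bs t → nth (decode k (alt l ∷ bs)) (eval k l + t) ≡ nth (decode k bs) t
nth-alt-after k l bs t =
  trans (cong (λ n → nth (alternating 0 (eval k l) ++ decode k bs) (n + t)) (sym (length-alternating 0 (eval k l))))
        (nth-++ʳ (alternating 0 (eval k l)) (decode k bs) t)

delayed : ℕ → List ℕ → ℕ → Maybe ℕ
delayed zero xs t = nth xs t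
delayed (suc d) xs zero = nothing
delayed (suc d) xs (suc t) = delayed d xs t

delayed-shift : ∀ n d xs t → delayed (n + d) xs (n + t) ≡ delayed d xs t
delayed-shift zero d xs t = refl
delayed-shift (suc n) d xs t = delayed-shift n d xs t

delayed-before : ∀ d xs t → t < d → delayed d xs t ≡ nothing
delayed-before (suc d) xs zero _ = refl
delayed-before (suc d) xs (suc t) (s≤s t<d) = delayed-before d xs t t<d

delayed-after : ∀ d xs t → delayed d xs (d + t) ≡ nth xs t
delayed-after zero xs t = refl
delayed-after (suc d) xs t = delayed-after d xs t

delayed-after′ : ∀ d xs t → delayed d xs (t + d) ≡ nth xs t
delayed-after′ d xs t = trans (cong (delayed d xs) (+-comm t d)) (delayed-after d xs t)

-- A track is a symbolic word delayed by a symbolic amount.  A verification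
-- runs along a list of tracks and inspects the column of letters at each position.
Track : Set
Track = SymLen × List Block

trackAt : ℕ → Track → ℕ → Maybe ℕ
trackAt k (d , bs) x = delayed (eval k d) (decode k bs) x

column : ℕ → List Track → ℕ → List (Maybe ℕ)
column k ts x = map (λ tr → trackAt k tr x) ts

-- The columns that matter are those where the first track is defined.
Live : List (Maybe ℕ) → Set
Live (just _ ∷ _) = ⊤
Live _ = ⊥

-- A cursor is a place on a track: inside the remaining delay, or at an offset
-- inside the current block.  cursorAt k c t is the letter t positions ahead.
data Cursor : Set where
  waiting : SymLen → List Block → Cursor
  reading : List Block → SymLen → Cursor

cursorAt : ℕ → Cursor → ℕ → Maybe ℕ
cursorAt k (waiting d bs) t = delayed (eval k d) (decode k bs) t
cursorAt k (reading bs o) t = nth (decode k bs) (eval k o + t)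

enter : List Block → SymLen → Cursor
enter (alt l ∷ bs) o with T? (l ==ˢ o)
... | yes _ = enter bs (0 , 0)
... | no _ = reading (alt l ∷ bs) o
enter bs o = reading bs o

enter-sound : ∀ k bs o t → cursorAt k (enter bs o) t ≡ cursorAt k (reading bs o) t
enter-sound k [] o t = refl
enter-sound k (letter v ∷ bs) o t = refl
enter-sound k (alt l ∷ bs) o t with T? (l ==ˢ o)
... | no _ = refl
... | yes l=o = begin
  cursorAt k (enter bs (0 , 0)) t                 ≡⟨ enter-sound k bs (0 , 0) t ⟩
  nth (decode k bs) t                             ≡⟨ sym (nth-alt-after k l bs t) ⟩
  nth (decode k (alt l ∷ bs)) (eval k l + t)      ≡⟨ cong (λ m → nth (decode k (alt l ∷ bs)) (eval k m + t)) (==ˢ-sound l o l=o) ⟩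
  cursorAt k (reading (alt l ∷ bs) o) t           ∎
  where open ≡-Reasoning

wait : SymLen → List Block → Cursor
wait (zero , zero) bs = enter bs (0 , 0)
wait d bs = waiting d bs

wait-sound : ∀ k d bs t → cursorAt k (wait d bs) t ≡ cursorAt k (waiting d bs) t
wait-sound k (zero , zero) bs t = enter-sound k bs (0 , 0) t
wait-sound k (zero , suc b) bs t = refl
wait-sound k (suc a , b) bs t = refl

remaining : Cursor → Maybe SymLen
remaining (waiting d _) = just d
remaining (reading [] _) = nothing
remaining (reading (letter _ ∷ _) _) = just (0 , 1)
remaining (reading (alt l ∷ _) o) = just (l ⊖ o)

wellPlaced : Cursor → Bool
wellPlaced (waiting _ _) = true
wellPlaced (reading [] _) = true
wellPlaced (reading (letter _ ∷ _) o) = o ==ˢ (0 , 0)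
wellPlaced (reading (alt l ∷ _) o) = o ≤ˢ l

canMove : SymLen → Cursor → Bool
canMove L c = wellPlaced c ∧ maybe (L ≤ˢ_) true (remaining c)

-- Phases have nonzero length, so the sweep makes progress.
nonZero : SymLen → Bool
nonZero (zero , zero) = false
nonZero _ = true

unit-length : ∀ L → T (L ≤ˢ (0 , 1)) → T (nonZero L) → L ≡ (0 , 1)
unit-length (zero , zero) _ ()
unit-length (zero , suc zero) _ _ = refl
unit-length (zero , suc (suc b)) () _
unit-length (suc a , b) () _

-- Inside a phase every cursor shows either nothing, a fixed letter, or an
-- alternating letter; in all cases the letter depends only on the parity π.
phaseValue : ℕ → Cursor → Maybe ℕ
phaseValue π (waiting _ _) = nothing
phaseValue π (reading [] _) = nothing
phaseValue π (reading (letter v ∷ _) _) = just v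
phaseValue π (reading (alt _ ∷ _) (_ , b)) = just (parity (b + π))

advance : SymLen → Cursor → Cursor
advance L (waiting d bs) = wait (d ⊖ L) bs
advance L (reading [] o) = reading [] o
advance L (reading (letter _ ∷ bs) o) = enter bs (0 , 0)
advance L (reading (alt l ∷ bs) o) = enter (alt l ∷ bs) (o ⊕ L)

advance-sound : ∀ k L c t → T (canMove L c) → T (nonZero L) →
  cursorAt k (advance L c) t ≡ cursorAt k c (eval k L + t)
advance-sound k L (waiting d bs) t L≤d _ = begin
  cursorAt k (wait (d ⊖ L) bs) t                                  ≡⟨ wait-sound k (d ⊖ L) bs t ⟩
  delayed (eval k (d ⊖ L)) (decode k bs) t                        ≡⟨ sym (delayed-shift (eval k L) _ (decode k bs) t) ⟩
  delayed (eval k L + eval k (d ⊖ L)) (decode k bs) (eval k L + t) ≡⟨ cong (λ n → delayed n (decode k bs) (eval k L + t)) (eval-⊖ k d L L≤d) ⟩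
  delayed (eval k d) (decode k bs) (eval k L + t)                  ∎
  where open ≡-Reasoning
advance-sound k L (reading [] o) t _ _ = refl
advance-sound k L (reading (letter v ∷ bs) o) t ok nz with to T-∧ ok
... | o=0 , L≤1 with ==ˢ-sound o (0 , 0) o=0 | unit-length L L≤1 nz
... | refl | refl = enter-sound k bs (0 , 0) t
advance-sound k L (reading (alt l ∷ bs) o) t _ _ =
  trans (enter-sound k (alt l ∷ bs) (o ⊕ L) t)
        (cong (nth (decode k (alt l ∷ bs))) (trans (cong (_+ t) (eval-⊕ k o L)) (+-assoc (eval k o) (eval k L) t)))

phaseValue-sound : ∀ k L c t → T (canMove L c) → T (nonZero L) → t < eval k L →
  cursorAt k c t ≡ phaseValue (parity t) c
phaseValue-sound k L (waiting d bs) t L≤d _ t<L =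
  delayed-before (eval k d) (decode k bs) t (<-≤-trans t<L (eval-mono k L d L≤d))
phaseValue-sound k L (reading [] o) t _ _ _ = refl
phaseValue-sound k L (reading (letter v ∷ bs) o) t ok nz t<L with to T-∧ ok
... | o=0 , L≤1 with ==ˢ-sound o (0 , 0) o=0 | unit-length L L≤1 nz
phaseValue-sound k L (reading (letter v ∷ bs) o) zero ok nz t<L | _ | refl | refl = refl
phaseValue-sound k L (reading (letter v ∷ bs) o) (suc t) ok nz (s≤s ()) | _ | refl | refl
phaseValue-sound k L (reading (alt l ∷ bs) (a , b)) t ok _ t<L with to T-∧ ok
... | o≤l , L≤rest = trans (nth-alt-inside k l bs (eval k (a , b) + t) inside) (cong just (parity-eval k a b t))
  where
  inside : eval k (a , b) + t < eval k l
  inside = subst (eval k (a , b) + t <_) (eval-⊖ k l (a , b) o≤l)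
                 (+-monoʳ-< (eval k (a , b)) (<-≤-trans t<L (eval-mono k L (l ⊖ (a , b)) L≤rest)))

Pred : Set
Pred = List (Maybe ℕ) → Bool

phaseColumn : ℕ → List Cursor → List (Maybe ℕ)
phaseColumn π cs = map (phaseValue π) cs

phaseColumn-sound : ∀ k L cs t → All (λ c → T (canMove L c)) cs → T (nonZero L) → t < eval k L →
  map (λ c → cursorAt k c t) cs ≡ phaseColumn (parity t) cs
phaseColumn-sound k L [] t [] _ _ = refl
phaseColumn-sound k L (c ∷ cs) t (ok ∷ oks) nz t<L =
  cong₂ _∷_ (phaseValue-sound k L c t ok nz t<L) (phaseColumn-sound k L cs t oks nz t<L)

advance-all : ∀ k L cs t → All (λ c → T (canMove L c)) cs → T (nonZero L) →
  map (λ c → cursorAt k c t) (map (advance L) cs) ≡ map (λ c → cursorAt k c (eval k L + t)) cs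
advance-all k L [] t [] _ = refl
advance-all k L (c ∷ cs) t (ok ∷ oks) nz =
  cong₂ _∷_ (advance-sound k L c t ok nz) (advance-all k L cs t oks nz)

-- Both
-- parities are checked; a failure is tolerated only on a phase of length one,
-- and its position M is then reported as an exception.
checkPhase : Pred → SymLen → SymLen → List Cursor → Maybe (List SymLen)
checkPhase P M L cs with T? (L ==ˢ (0 , 1)) | T? (P (phaseColumn 0 cs)) | T? (P (phaseColumn 1 cs))
... | yes _ | yes _ | _ = just []
... | yes _ | no _ | _ = just (M ∷ [])
... | no _ | yes _ | yes _ = just []
... | no _ | _ | _ = nothing

checkPhase-sound : ∀ k P M L cs ex → checkPhase P M L cs ≡ just ex → ∀ t → t < eval k L →
  T (P (phaseColumn (parity t) cs)) ⊎ eval k M + t ∈ map (eval k) ex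
checkPhase-sound k P M L cs ex eq t t<L
  with T? (L ==ˢ (0 , 1)) | T? (P (phaseColumn 0 cs)) | T? (P (phaseColumn 1 cs))
... | no _ | yes p₀ | yes p₁ = inj₁ (either-parity (parity-cases t))
  where
  either-parity : parity t ≡ 0 ⊎ parity t ≡ 1 → T (P (phaseColumn (parity t) cs))
  either-parity (inj₁ even) rewrite even = p₀
  either-parity (inj₂ odd) rewrite odd = p₁
checkPhase-sound k P M L cs ex () t t<L | no _ | yes _ | no _
checkPhase-sound k P M L cs ex () t t<L | no _ | no _ | _
... | yes L=1 | _ | _ with ==ˢ-sound L (0 , 1) L=1 | t | t<L
... | refl | suc _ | s≤s ()
checkPhase-sound k P M L cs .[] refl t t<L | yes _ | yes p₀ | _ | refl | zero | _ = inj₁ p₀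
checkPhase-sound k P M L cs .(M ∷ []) refl t t<L | yes _ | no _ | _ | refl | zero | _ = inj₂ (here (+-identityʳ (eval k M)))

-- The phase length is the first remaining length that is ≤ˢ all the others.
-- (This choice is untrusted: the sweep checks that every cursor can move.)
smallest : List SymLen → List SymLen → Maybe SymLen
smallest rs [] = nothing
smallest rs (x ∷ xs) = if all (x ≤ˢ_) rs then just x else smallest rs xs

phaseLength : List Cursor → Maybe SymLen
phaseLength cs = smallest (catMaybes (map remaining cs)) (catMaybes (map remaining cs))

exhausted : List Cursor → Bool
exhausted (reading [] _ ∷ _) = true
exhausted _ = false

_++?_ : Maybe (List SymLen) → Maybe (List SymLen) → Maybe (List SymLen)
just xs ++? just ys = just (xs ++ ys)
_ ++? _ = nothing

sweep : ℕ → Pred → SymLen → List Cursor → Maybe (List SymLen)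
sweep zero P M cs = nothing
sweep (suc fuel) P M cs with T? (exhausted cs) | phaseLength cs
... | yes _ | _ = just []
... | no _ | nothing = nothing
... | no _ | just L with T? (nonZero L) | All.all? (λ c → T? (canMove L c)) cs
...   | yes _ | yes _ = checkPhase P M L cs ++? sweep fuel P (M ⊕ L) (map (advance L) cs)
...   | _ | _ = nothing

++?-just : ∀ a b {ex} → a ++? b ≡ just ex → ∃₂ λ xs ys → a ≡ just xs × b ≡ just ys × ex ≡ xs ++ ys
++?-just (just xs) (just ys) refl = xs , ys , refl , refl , refl
++?-just (just xs) nothing ()
++?-just nothing b ()

exhausted-dead : ∀ k cs t → T (exhausted cs) → ¬ Live (map (λ c → cursorAt k c t) cs)
exhausted-dead k (reading [] _ ∷ _) t _ ()
exhausted-dead k [] t ()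
exhausted-dead k (waiting _ _ ∷ _) t ()
exhausted-dead k (reading (_ ∷ _) _ ∷ _) t ()

position-⊕ : ∀ k M L u → eval k M + (eval k L + u) ≡ eval k (M ⊕ L) + u
position-⊕ k M L u = trans (sym (+-assoc (eval k M) (eval k L) u)) (cong (_+ u) (sym (eval-⊕ k M L)))

exceptionˡ : ∀ k {x} e₁ e₂ → x ∈ map (eval k) e₁ → x ∈ map (eval k) (e₁ ++ e₂)
exceptionˡ k e₁ e₂ m = subst (_ ∈_) (sym (map-++ (eval k) e₁ e₂)) (∈-++⁺ˡ m)

exceptionʳ : ∀ k {x} e₁ e₂ → x ∈ map (eval k) e₂ → x ∈ map (eval k) (e₁ ++ e₂)
exceptionʳ k e₁ e₂ m = subst (_ ∈_) (sym (map-++ (eval k) e₁ e₂)) (∈-++⁺ʳ (map (eval k) e₁) m)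

Shows : ℕ → (ℕ → List (Maybe ℕ)) → SymLen → List Cursor → Set
Shows k col M cs = ∀ t → map (λ c → cursorAt k c t) cs ≡ col (eval k M + t)

sweep-sound : ∀ k col fuel P M cs ex → sweep fuel P M cs ≡ just ex → Shows k col M cs →
  ∀ t → Live (col (eval k M + t)) → T (P (col (eval k M + t))) ⊎ eval k M + t ∈ map (eval k) ex
sweep-sound k col zero P M cs ex () shows t live
sweep-sound k col (suc fuel) P M cs ex eq shows t live with T? (exhausted cs) | phaseLength cs
... | yes fin | _ = ⊥-elim (exhausted-dead k cs t fin (subst Live (sym (shows t)) live))
sweep-sound k col (suc fuel) P M cs ex () shows t live | no _ | nothing
... | no _ | just L with T? (nonZero L) | All.all? (λ c → T? (canMove L c)) cs
sweep-sound k col (suc fuel) P M cs ex () shows t live | no _ | just L | no _ | _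
sweep-sound k col (suc fuel) P M cs ex () shows t live | no _ | just L | yes _ | no _
... | yes nz | yes oks with ++?-just (checkPhase P M L cs) _ eq
... | e₁ , e₂ , phase≡ , rest≡ , refl with t <? eval k L
...   | yes t<L = Sum.map (subst (T ∘ P) (sym column≡)) (exceptionˡ k e₁ e₂) (checkPhase-sound k P M L cs e₁ phase≡ t t<L)
  where
  column≡ : col (eval k M + t) ≡ phaseColumn (parity t) cs
  column≡ = trans (sym (shows t)) (phaseColumn-sound k L cs t oks nz t<L)
...   | no t≮L = subst (λ x → T (P (col x)) ⊎ x ∈ map (eval k) (e₁ ++ e₂)) later≡
                   (Sum.map₂ (exceptionʳ k e₁ e₂) (sweep-sound k col fuel P (M ⊕ L) (map (advance L) cs) e₂ rest≡ shows′ t′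
                                                                (subst (Live ∘ col) (sym later≡) live)))
  where
  t′ : ℕ
  t′ = t ∸ eval k L
  later≡ : eval k (M ⊕ L) + t′ ≡ eval k M + t
  later≡ = trans (sym (position-⊕ k M L t′)) (cong (eval k M +_) (m+[n∸m]≡n (≮⇒≥ t≮L)))
  shows′ : Shows k col (M ⊕ L) (map (advance L) cs)
  shows′ u = trans (advance-all k L cs u oks nz) (trans (shows (eval k L + u)) (cong col (position-⊕ k M L u)))

startCursor : Track → Cursor
startCursor (d , bs) = wait d bs

start-shows : ∀ k ts → Shows k (column k ts) (0 , 0) (map startCursor ts)
start-shows k [] t = refl
start-shows k ((d , bs) ∷ ts) t = cong₂ _∷_ (wait-sound k d bs t) (start-shows k ts t)

verify : ℕ → Pred → List Track → Maybe (List SymLen)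
verify fuel P ts = sweep fuel P (0 , 0) (map startCursor ts)

data Verified (P : Pred) (ts : List Track) (ex : List SymLen) : Set where
  by-sweep : ∀ fuel → verify fuel P ts ≡ just ex → Verified P ts ex

verify-sound : ∀ {P ts ex} → Verified P ts ex → ∀ k x → Live (column k ts x) →
  T (P (column k ts x)) ⊎ x ∈ map (eval k) ex
verify-sound {P} {ts} {ex} (by-sweep fuel ok) k x =
  sweep-sound k (column k ts) fuel P (0 , 0) (map startCursor ts) ex ok (start-shows k ts) x

verify-exact : ∀ {P ts} → Verified P ts [] → ∀ k x {v vs} → column k ts x ≡ just v ∷ vs → T (P (just v ∷ vs))
verify-exact {P} ok k x column≡ with verify-sound ok k x (subst Live (sym column≡) tt)
... | inj₁ p = subst (T ∘ P) column≡ p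
... | inj₂ ()

values-nth : ∀ S m i → i < m → nth (values S m) i ≡ just (grundy S (m ∸ suc i))
values-nth S (suc m) zero _ = refl
values-nth S (suc m) (suc i) (s≤s i<m) = values-nth S m i i<m

values-past : ∀ S m s → 1 ≤ s → s ≤ m → nth (values S m) (s ∸ 1) ≡ just (grundy S (m ∸ s))
values-past S m s 1≤s s≤m =
  trans (values-nth S m (s ∸ 1) (subst (_≤ m) (sym (m+[n∸m]≡n 1≤s)) s≤m))
        (cong (λ d → just (grundy S (m ∸ d))) (m+[n∸m]≡n 1≤s))

options-positive : ∀ S prev → All (1 ≤_) S → options S prev ≡ catMaybes (map (λ s → nth prev (s ∸ 1)) S)
options-positive [] prev [] = refl
options-positive (suc i ∷ S) prev (_ ∷ positive) with nth prev i
... | just v = cong (v ∷_) (options-positive S prev positive)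
... | nothing = options-positive S prev positive

grundy-via : ∀ S n (past : ℕ → Maybe ℕ) → All (λ s → 1 ≤ s × nth (values S n) (s ∸ 1) ≡ past s) S →
  grundy S n ≡ mex (catMaybes (map past S))
grundy-via S n past h =
  cong mex (trans (options-positive S (values S n) (All.map proj₁ h)) (cong catMaybes (map-cong-local (All.map proj₂ h))))

optionsIn : List ℕ → List ℕ → ℕ → List ℕ
optionsIn S E n = catMaybes (map (λ s → delayed s E n) S)

values-delayed : ∀ S E n → (∀ m → m < n → nth E m ≡ just (grundy S m)) →
  ∀ i → nth (values S n) i ≡ delayed (suc i) E n
values-delayed S E zero h i = refl
values-delayed S E (suc n) h zero = sym (h n ≤-refl)
values-delayed S E (suc n) h (suc i) = values-delayed S E n (λ m m<n → h m (m<n⇒m<1+n m<n)) i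

nim-prefix : ∀ S E → All (1 ≤_) S → (∀ n {x} → nth E n ≡ just x → x ≡ mex (optionsIn S E n)) →
  ∀ n → n < length E → nth E n ≡ just (grundy S n)
nim-prefix S E positive rule = <-rec _ (λ n ih → step n (λ m → ih {m}))
  where
  step : ∀ n → (∀ m → m < n → m < length E → nth E m ≡ just (grundy S m)) →
    n < length E → nth E n ≡ just (grundy S n)
  step n ih n<len with nth-defined E n n<len
  ... | x , Eₙ = trans Eₙ (cong just (trans (rule n Eₙ) (sym (grundy-via S n _ (All.map agree positive)))))
    where
    agree : ∀ {s} → 1 ≤ s → 1 ≤ s × nth (values S n) (s ∸ 1) ≡ delayed s E n
    agree {s} 1≤s = 1≤s , trans (values-delayed S E n (λ m m<n → ih m m<n (<-trans m<n n<len)) (s ∸ 1))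
                                (cong (λ d → delayed d E n) (m+[n∸m]≡n 1≤s))

PeriodicFrom : (ℕ → ℕ) → ℕ → ℕ → Set
PeriodicFrom G p n₀ = ∀ n → n₀ ≤ n → G (n + p) ≡ G n

periodic-from-window : ∀ S m p n₀ → All (λ s → 1 ≤ s × s ≤ m) S →
  (∀ n → n₀ ≤ n → n < n₀ + m → grundy S (n + p) ≡ grundy S n) → PeriodicFrom (grundy S) p n₀
periodic-from-window S m p n₀ moves window = <-rec _ (λ n ih → step n (λ m′ → ih {m′}))
  where
  G : ℕ → ℕ
  G = grundy S
  step : ∀ n → (∀ m′ → m′ < n → n₀ ≤ m′ → G (m′ + p) ≡ G m′) → n₀ ≤ n → G (n + p) ≡ G n
  step n ih n₀≤n with n <? n₀ + m
  ... | yes inside = window n n₀≤n inside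
  ... | no beyond = trans (grundy-via S (n + p) _ (All.map shifted moves)) (sym (grundy-via S n _ (All.map unshifted moves)))
    where
    move≤n : ∀ {s} → s ≤ m → s ≤ n
    move≤n s≤m = ≤-trans s≤m (m+n≤o⇒n≤o n₀ (≮⇒≥ beyond))
    unshifted : ∀ {s} → 1 ≤ s × s ≤ m → 1 ≤ s × nth (values S n) (s ∸ 1) ≡ just (G (n ∸ s))
    unshifted (1≤s , s≤m) = 1≤s , values-past S n _ 1≤s (move≤n s≤m)
    shifted : ∀ {s} → 1 ≤ s × s ≤ m → 1 ≤ s × nth (values S (n + p)) (s ∸ 1) ≡ just (G (n ∸ s))
    shifted {s} (1≤s , s≤m) = 1≤s , (begin
      nth (values S (n + p)) (s ∸ 1)   ≡⟨ values-past S (n + p) s 1≤s (≤-trans (move≤n s≤m) (m≤m+n n p)) ⟩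
      just (G (n + p ∸ s))             ≡⟨ cong (λ x → just (G x)) (+-∸-comm p (move≤n s≤m)) ⟩
      just (G (n ∸ s + p))             ≡⟨ cong just (ih (n ∸ s) (∸-monoʳ-< 1≤s (move≤n s≤m)) n₀≤n∸s) ⟩
      just (G (n ∸ s))                 ∎)
      where
      open ≡-Reasoning
      n₀≤n∸s : n₀ ≤ n ∸ s
      n₀≤n∸s = m+n≤o⇒m≤o∸n n₀ (≤-trans (+-monoʳ-≤ n₀ s≤m) (≮⇒≥ beyond))

module Periodic (G : ℕ → ℕ) (p n₀ : ℕ) (p>0 : 0 < p) (periodic : PeriodicFrom G p n₀) where

  periodic-mul : ∀ q n → n₀ ≤ n → G (n + q * p) ≡ G n
  periodic-mul zero n n₀≤n = cong G (+-identityʳ n)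
  periodic-mul (suc q) n n₀≤n =
    trans (cong G (sym (+-assoc n p (q * p))))
          (trans (periodic-mul q (n + p) (≤-trans n₀≤n (m≤m+n n p))) (periodic n n₀≤n))

  periodic-offset : ∀ q i → G (n₀ + (q * p + i)) ≡ G (n₀ + i)
  periodic-offset q i =
    trans (cong G (x∙yz≈xz∙y n₀ (q * p) i)) (periodic-mul q (n₀ + i) (m≤m+n n₀ i))

  not-eventual-period : ∀ {c q} → n₀ ≤ c → G (c + q) ≢ G c → ¬ EventuallyPeriodic G q
  not-eventual-period {c} {q} n₀≤c differ (N , eventually) = differ (begin
    G (c + q)              ≡⟨ sym (periodic-mul N (c + q) (≤-trans n₀≤c (m≤m+n c q))) ⟩
    G (c + q + N * p)      ≡⟨ cong G (xy∙z≈xz∙y c q (N * p)) ⟩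
    G (c + N * p + q)      ≡⟨ eventually (c + N * p) N≤ ⟩
    G (c + N * p)          ≡⟨ periodic-mul N c n₀≤c ⟩
    G c                    ∎)
    where
    open ≡-Reasoning
    N≤ : N ≤ c + N * p
    N≤ = ≤-trans (subst (_≤ N * p) (*-identityʳ N) (*-monoʳ-≤ N p>0)) (m≤n+m (N * p) c)

  -- s is in the expansion as soon as G(n + s) ≠ G(n) for all n + s below a
  -- bound B ≥ n₀ + p + s: the later positions repeat the earlier ones.
  unequal-from-range : ∀ s B → n₀ + p + s ≤ B → (∀ n → n + s < B → G (n + s) ≢ G n) → ∀ n → G (n + s) ≢ G n
  unequal-from-range s B bound below = <-rec _ (λ n ih → step n (λ m → ih {m}))
    where
    step : ∀ n → (∀ m → m < n → G (m + s) ≢ G m) → G (n + s) ≢ G n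
    step n ih with n + s <? B
    ... | yes n+s<B = below n n+s<B
    ... | no n+s≮B = λ same → ih n′ n′<n (begin
      G (n′ + s)        ≡⟨ sym (periodic (n′ + s) (≤-trans n₀≤n′ (m≤m+n n′ s))) ⟩
      G (n′ + s + p)    ≡⟨ cong G (xy∙z≈xz∙y n′ s p) ⟩
      G (n′ + p + s)    ≡⟨ cong (λ x → G (x + s)) n′+p≡n ⟩
      G (n + s)         ≡⟨ same ⟩
      G n               ≡⟨ cong G (sym n′+p≡n) ⟩
      G (n′ + p)        ≡⟨ periodic n′ n₀≤n′ ⟩
      G n′              ∎)
      where
      open ≡-Reasoning
      n₀+p≤n : n₀ + p ≤ n
      n₀+p≤n = +-cancelʳ-≤ s (n₀ + p) n (≤-trans bound (≮⇒≥ n+s≮B))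
      n′ : ℕ
      n′ = n ∸ p
      n′+p≡n : n′ + p ≡ n
      n′+p≡n = m∸n+n≡m (m+n≤o⇒n≤o n₀ n₀+p≤n)
      n₀≤n′ : n₀ ≤ n′
      n₀≤n′ = m+n≤o⇒m≤o∸n n₀ n₀+p≤n
      n′<n : n′ < n
      n′<n = ∸-monoʳ-< p>0 (m+n≤o⇒n≤o n₀ n₀+p≤n)

  equal-from-range : (∀ s → n₀ ≤ s → s < n₀ + p → ∃ λ n → G (n + s) ≡ G n) → ∀ s → n₀ ≤ s → ∃ λ n → G (n + s) ≡ G n
  equal-from-range inRange = <-rec _ (λ s ih → step s (λ m → ih {m}))
    where
    step : ∀ s → (∀ m → m < s → n₀ ≤ m → ∃ λ n → G (n + m) ≡ G n) → n₀ ≤ s → ∃ λ n → G (n + s) ≡ G n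
    step s ih n₀≤s with s <? n₀ + p
    ... | yes s<n₀+p = inRange s n₀≤s s<n₀+p
    ... | no s≮n₀+p = shift-back (ih (s ∸ p) (∸-monoʳ-< p>0 p≤s) n₀≤s∸p)
      where
      n₀≤s∸p : n₀ ≤ s ∸ p
      n₀≤s∸p = m+n≤o⇒m≤o∸n n₀ (≮⇒≥ s≮n₀+p)
      p≤s : p ≤ s
      p≤s = m+n≤o⇒n≤o n₀ (≮⇒≥ s≮n₀+p)
      shift-back : (∃ λ n → G (n + (s ∸ p)) ≡ G n) → ∃ λ n → G (n + s) ≡ G n
      shift-back (n , same) = n , (begin
        G (n + s)              ≡⟨ cong (λ x → G (n + x)) (sym (m∸n+n≡m p≤s)) ⟩
        G (n + (s ∸ p + p))    ≡⟨ cong G (sym (+-assoc n (s ∸ p) p)) ⟩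
        G (n + (s ∸ p) + p)    ≡⟨ periodic (n + (s ∸ p)) (≤-trans n₀≤s∸p (m≤n+m (s ∸ p) n)) ⟩
        G (n + (s ∸ p))        ≡⟨ same ⟩
        G n                    ∎)
        where open ≡-Reasoning

mexRule : Pred
mexRule (just x ∷ vs) = x ≡ᵇ mex (catMaybes vs)
mexRule _ = true

agreeWhereGuarded : Pred
agreeWhereGuarded (just x ∷ just y ∷ just _ ∷ []) = x ≡ᵇ y
agreeWhereGuarded _ = true

agree : Pred
agree (just x ∷ just y ∷ []) = x ≡ᵇ y
agree _ = true

differsFrom : ℕ → Maybe ℕ → Bool
differsFrom x (just y) = not (x ≡ᵇ y)
differsFrom x nothing = true

allDiffer : Pred
allDiffer (just x ∷ vs) = all (differsFrom x) vs
allDiffer _ = true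

-- A candidate is a symbolic position together with its claimed letter.
Candidate : Set
Candidate = SymLen × ℕ

matches : Maybe ℕ → Candidate → Bool
matches (just y) c = y ≡ᵇ proj₂ c
matches nothing _ = false

mismatches : Maybe ℕ → Candidate → Bool
mismatches (just y) c = not (y ≡ᵇ proj₂ c)
mismatches nothing _ = false

someMatch : List Candidate → Pred
someMatch cs (just _ ∷ vs) = or (zipWith matches vs cs)
someMatch cs _ = true

someMismatch : List Candidate → Pred
someMismatch cs (just _ ∷ vs) = or (zipWith mismatches vs cs)
someMismatch cs _ = true

valueIs : ℕ → Maybe ℕ → Candidate → Bool
valueIs x (just _) c = x ≡ᵇ proj₂ c
valueIs x nothing _ = true

lookupRule : List Candidate → Pred
lookupRule cs (just x ∷ ms) = and (zipWith (valueIs x) ms cs)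
lookupRule cs _ = true

not-both : ∀ {b} → T (not b) → T b → ⊥
not-both {false} _ ()

matches-sound : ∀ m c → T (matches m c) → m ≡ just (proj₂ c)
matches-sound (just y) c t = cong just (≡ᵇ⇒≡ y (proj₂ c) t)

mismatches-sound : ∀ m c → T (mismatches m c) → ∃ λ y → m ≡ just y × y ≢ proj₂ c
mismatches-sound (just y) c t = y , refl , λ y≡c → not-both t (≡⇒≡ᵇ y (proj₂ c) y≡c)

or-zipWith : ∀ {A : Set} (rel : Maybe ℕ → A → Bool) (f : A → Maybe ℕ) xs →
  T (or (zipWith rel (map f xs) xs)) → ∃ λ a → a ∈ xs × T (rel (f a) a)
or-zipWith rel f (a ∷ xs) t with to T-∨ t
... | inj₁ now = a , here refl , now
... | inj₂ later with or-zipWith rel f xs later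
...   | b , b∈xs , r = b , there b∈xs , r

and-zipWith : ∀ {A : Set} (rel : Maybe ℕ → A → Bool) (f : A → Maybe ℕ) xs →
  T (and (zipWith rel (map f xs) xs)) → ∀ {a} → a ∈ xs → T (rel (f a) a)
and-zipWith rel f (a ∷ xs) t (here refl) = proj₁ (to T-∧ t)
and-zipWith rel f (b ∷ xs) t (there a∈xs) = and-zipWith rel f xs (proj₂ (to T-∧ t)) a∈xs

column-map : ∀ {A : Set} k (h : A → Track) xs x → column k (map h xs) x ≡ map (λ a → trackAt k (h a) x) xs
column-map k h xs x = sym (map-∘ xs)

nimTracks : List SymLen → List Block → List Track
nimTracks moves E = ((0 , 0) , E) ∷ map (λ d → (d , E)) moves

-- E, E delayed by the period, and a guard defined from start + period on.
periodTracks : SymLen → SymLen → List Block → List Track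
periodTracks start period E = ((0 , 0) , E) ∷ (period , E) ∷ (start ⊕ period , E) ∷ []

cycleTracks : SymLen → List Block → List Block → List Track
cycleTracks start E W = ((0 , 0) , E) ∷ (start , W) ∷ []

expansionTracks : List Block → List SymLen → List Track
expansionTracks E ts = ((0 , 0) , E) ∷ map (λ t → (t , E)) ts

-- Defined exactly at the positions J + s with 1 ≤ s < R.
rangeTrack : SymLen → SymLen → Track
rangeTrack J R = J ⊕ (0 , 1) , alt (R ⊖ (0 , 1)) ∷ []

-- At position J + s the candidate track of c shows the letter of E at c + s.
candidateTracks : SymLen → List Block → List Candidate → List Track
candidateTracks J E cs = map (λ c → (J ⊖ proj₁ c , E)) cs

lookupTracks : List Block → List Candidate → List Track
lookupTracks E cs = ((0 , 0) , E) ∷ map (λ c → (proj₁ c , letter 0 ∷ [])) cs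

rangeTrack-defined : ∀ k J R s → T ((0 , 1) ≤ˢ R) → 1 ≤ s → s < eval k R →
  ∃ λ v → trackAt k (rangeTrack J R) (s + eval k J) ≡ just v
rangeTrack-defined k J R (suc s) 1≤R _ s<R = parity s , (begin
  delayed (eval k (J ⊕ (0 , 1))) (decode k (alt (R ⊖ (0 , 1)) ∷ [])) (suc s + eval k J)
    ≡⟨ cong₂ (λ d x → delayed d (decode k (alt (R ⊖ (0 , 1)) ∷ [])) x) (eval-⊕ k J (0 , 1)) position ⟩
  delayed (eval k J + 1) (decode k (alt (R ⊖ (0 , 1)) ∷ [])) ((eval k J + 1) + s)
    ≡⟨ delayed-after (eval k J + 1) _ s ⟩
  nth (decode k (alt (R ⊖ (0 , 1)) ∷ [])) s
    ≡⟨ nth-alt-inside k (R ⊖ (0 , 1)) [] s s<R-1 ⟩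
  just (parity s) ∎)
  where
  open ≡-Reasoning
  position : suc s + eval k J ≡ (eval k J + 1) + s
  position = xy∙z≈zx∙y 1 s (eval k J)
  s<R-1 : s < eval k (R ⊖ (0 , 1))
  s<R-1 = +-cancelˡ-< 1 s _ (subst (suc s <_) (sym (eval-⊖ k R (0 , 1) 1≤R)) s<R)

candidateTrack-value : ∀ k J c E s → T (c ≤ˢ J) →
  trackAt k (J ⊖ c , E) (s + eval k J) ≡ nth (decode k E) (eval k c + s)
candidateTrack-value k J c E s c≤J = begin
  delayed (eval k (J ⊖ c)) (decode k E) (s + eval k J)
    ≡⟨ cong (delayed (eval k (J ⊖ c)) (decode k E)) position ⟩
  delayed (eval k (J ⊖ c)) (decode k E) (eval k (J ⊖ c) + (eval k c + s))
    ≡⟨ delayed-after (eval k (J ⊖ c)) (decode k E) (eval k c + s) ⟩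
  nth (decode k E) (eval k c + s) ∎
  where
  open ≡-Reasoning
  position : s + eval k J ≡ eval k (J ⊖ c) + (eval k c + s)
  position = trans (cong (s +_) (sym (eval-⊖ k J c c≤J))) (x∙yz≈z∙yx s (eval k c) (eval k (J ⊖ c)))

marker-defined : ∀ k c → trackAt k (c , letter 0 ∷ []) (eval k c) ≡ just 0
marker-defined k c = trans (cong (delayed (eval k c) (0 ∷ [])) (sym (+-identityʳ (eval k c)))) (delayed-after (eval k c) (0 ∷ []) 0)

-- A certificate for a family of subtraction games indexed by k: all data are
-- symbolic and every check is a computation that does not involve k.
record Certificate : Set where
  field
    moves       : List SymLen
    maxMove     : SymLen
    prefix      : List Block          -- an initial segment of the nim-sequence
    start       : SymLen              -- G(n + period) = G(n) from n = start on
    period      : SymLen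
    cycle       : List Block          -- the letters of one period from start on
    expansion   : List SymLen
    repeatBase  : SymLen
    repeats     : List Candidate      -- positions c with G(c) = G(c + s), for s ∉ expansion
    breakBase   : SymLen
    breaks      : List Candidate      -- positions c ≥ start with G(c + q) ≠ G(c), for q < period
    moves-positive     : All (λ d → T ((0 , 1) ≤ˢ d)) moves
    moves-bounded      : All (λ d → T (d ≤ˢ maxMove)) moves
    period-positive    : T ((0 , 1) ≤ˢ period)
    start-positive     : T ((0 , 1) ≤ˢ start)
    cycle-length       : blocksLength cycle ≡ period
    prefix-long        : T ((start ⊕ period) ⊕ maxMove ≤ˢ blocksLength prefix)
    expansion-positive : All (λ t → T ((0 , 1) ≤ˢ t)) expansion
    expansion-early    : All (λ t → T (t ⊕ (0 , 1) ≤ˢ start)) expansion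
    expansion-covered  : All (λ t → T ((start ⊕ period) ⊕ t ≤ˢ blocksLength prefix)) expansion
    repeats-below      : All (λ c → T (proj₁ c ≤ˢ repeatBase)) repeats
    breaks-below       : All (λ c → T (proj₁ c ≤ˢ breakBase)) breaks
    breaks-late        : All (λ c → T (start ≤ˢ proj₁ c)) breaks
    prefix-is-nim      : Verified mexRule (nimTracks moves prefix) []
    prefix-periodic    : Verified agreeWhereGuarded (periodTracks start period prefix) []
    cycle-agrees       : Verified agree (cycleTracks start prefix cycle) []
    expansion-differs  : Verified allDiffer (expansionTracks prefix expansion) []
    repeats-found      : Verified (someMatch repeats)
                           (rangeTrack repeatBase (start ⊕ period) ∷ candidateTracks repeatBase prefix repeats)
                           (map (_⊕ repeatBase) expansion)
    breaks-found       : Verified (someMismatch breaks)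
                           (rangeTrack breakBase period ∷ candidateTracks breakBase prefix breaks) []
    repeats-values     : Verified (lookupRule repeats) (lookupTracks prefix repeats) []
    breaks-values      : Verified (lookupRule breaks) (lookupTracks prefix breaks) []

module Consequences (C : Certificate) (k : ℕ) where
  open Certificate C

  S : List ℕ
  S = map (eval k) moves

  G : ℕ → ℕ
  G = grundy S

  E : List ℕ
  E = decode k prefix

  W : List ℕ
  W = decode k cycle

  n₀ p : ℕ
  n₀ = eval k start
  p = eval k period

  Tₖ : List ℕ
  Tₖ = map (eval k) expansion

  ≤ˢ⇒≤ : ∀ x y → T (x ≤ˢ y) → eval k x ≤ eval k y
  ≤ˢ⇒≤ = eval-mono k

  positive : ∀ {d} → T ((0 , 1) ≤ˢ d) → 1 ≤ eval k d
  positive {d} = eval-mono k (0 , 1) d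

  within-prefix : ∀ {x y} → T (x ⊕ y ≤ˢ blocksLength prefix) → eval k x + eval k y ≤ length E
  within-prefix {x} {y} le = subst₂ _≤_ (eval-⊕ k x y) (sym (length-decode k prefix)) (≤ˢ⇒≤ (x ⊕ y) (blocksLength prefix) le)

  n₀+p≤ : ∀ {t} → T ((start ⊕ period) ⊕ t ≤ˢ blocksLength prefix) → n₀ + p + eval k t ≤ length E
  n₀+p≤ {t} le = subst (λ z → z + eval k t ≤ length E) (eval-⊕ k start period) (within-prefix {start ⊕ period} {t} le)

  p>0 : 0 < p
  p>0 = positive {period} period-positive

  prefix-nim : ∀ n → n < length E → nth E n ≡ just (G n)
  prefix-nim = nim-prefix S E moves≥1 rule
    where
    moves≥1 : All (1 ≤_) S
    moves≥1 = All-map⁺ (All.map (λ {d} → positive {d}) moves-positive)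
    rule : ∀ n {x} → nth E n ≡ just x → x ≡ mex (optionsIn S E n)
    rule n {x} Eₙ = ≡ᵇ⇒≡ x _ (subst (λ vs → T (x ≡ᵇ mex (catMaybes vs))) same checked)
      where
      delays : List (Maybe ℕ)
      delays = column k (map (λ d → (d , prefix)) moves) n
      checked : T (mexRule (just x ∷ delays))
      checked = verify-exact prefix-is-nim k n (cong (_∷ delays) Eₙ)
      same : delays ≡ map (λ s → delayed s E n) S
      same = trans (column-map k (λ d → (d , prefix)) moves n) (map-∘ moves)

  G-from-prefix : ∀ n {y} → nth E n ≡ just y → G n ≡ y
  G-from-prefix n Eₙ = just-injective (trans (sym (prefix-nim n (nth-bound E n Eₙ))) Eₙ)

  candidate-value : ∀ cs → Verified (lookupRule cs) (lookupTracks prefix cs) [] →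
    ∀ {c} → c ∈ cs → eval k (proj₁ c) < length E → G (eval k (proj₁ c)) ≡ proj₂ c
  candidate-value cs ok {c} c∈cs c<len = ≡ᵇ⇒≡ _ _ (subst (λ m → T (valueIs (G x) m c)) (marker-defined k (proj₁ c)) fits)
    where
    x : ℕ
    x = eval k (proj₁ c)
    marker : Candidate → Maybe ℕ
    marker c′ = trackAt k (proj₁ c′ , letter 0 ∷ []) x
    column≡ : column k (lookupTracks prefix cs) x ≡ just (G x) ∷ map marker cs
    column≡ = cong₂ _∷_ (prefix-nim x c<len) (column-map k (λ c′ → (proj₁ c′ , letter 0 ∷ [])) cs x)
    fits : T (valueIs (G x) (marker c) c)
    fits = and-zipWith (valueIs (G x)) marker cs (verify-exact ok k x column≡) c∈cs

  window : ∀ n → n₀ ≤ n → n < n₀ + eval k maxMove → G (n + p) ≡ G n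
  window n n₀≤n n<n₀+m = ≡ᵇ⇒≡ _ _ (verify-exact prefix-periodic k (n + p) column≡)
    where
    m : ℕ
    m = eval k maxMove
    n+p<len : n + p < length E
    n+p<len = ≤-trans (+-monoˡ-≤ p n<n₀+m) (subst (_≤ length E) (xy∙z≈xz∙y n₀ p m) (n₀+p≤ prefix-long))
    n<len : n < length E
    n<len = ≤-<-trans (m≤m+n n p) n+p<len
    position : n + p ≡ n₀ + p + (n ∸ n₀)
    position = trans (cong (_+ p) (sym (m+[n∸m]≡n n₀≤n))) (xy∙z≈xz∙y n₀ (n ∸ n₀) p)
    guard : delayed (eval k (start ⊕ period)) E (n + p) ≡ just (G (n ∸ n₀))
    guard = trans (cong₂ (λ d x → delayed d E x) (eval-⊕ k start period) position)
                  (trans (delayed-after (n₀ + p) E (n ∸ n₀)) (prefix-nim (n ∸ n₀) (≤-<-trans (m∸n≤m n n₀) n<len)))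
    column≡ : column k (periodTracks start period prefix) (n + p) ≡ just (G (n + p)) ∷ just (G n) ∷ just (G (n ∸ n₀)) ∷ []
    column≡ = cong₂ _∷_ (prefix-nim (n + p) n+p<len)
                (cong₂ _∷_ (trans (delayed-after′ p E n) (prefix-nim n n<len)) (cong (_∷ []) guard))

  periodic : PeriodicFrom G p n₀
  periodic = periodic-from-window S (eval k maxMove) p n₀ bounded window
    where
    bounded : All (λ s → 1 ≤ s × s ≤ eval k maxMove) S
    bounded = All-map⁺ (All.zipWith (λ {d} (d≥1 , d≤max) → positive {d} d≥1 , ≤ˢ⇒≤ d maxMove d≤max)
                                    (moves-positive , moves-bounded))

  open Periodic G p n₀ p>0 periodic

  n₀+p≤len : n₀ + p ≤ length E
  n₀+p≤len = ≤-trans (m≤m+n (n₀ + p) _) (n₀+p≤ prefix-long)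

  length-W : length W ≡ p
  length-W = trans (length-decode k cycle) (cong (eval k) cycle-length)

  cycle-letter : ∀ i → i < p → nth W i ≡ just (G (n₀ + i))
  cycle-letter i i<p with nth-defined W i (subst (i <_) (sym length-W) i<p)
  ... | w , Wᵢ = trans Wᵢ (cong just (sym (≡ᵇ⇒≡ _ _ (verify-exact cycle-agrees k (n₀ + i) column≡))))
    where
    column≡ : column k (cycleTracks start prefix cycle) (n₀ + i) ≡ just (G (n₀ + i)) ∷ just w ∷ []
    column≡ = cong₂ _∷_ (prefix-nim (n₀ + i) (<-≤-trans (+-monoʳ-< n₀ i<p) n₀+p≤len))
                        (cong (_∷ []) (trans (delayed-after n₀ W i) Wᵢ))

  candidateAt : SymLen → ℕ → Candidate → Maybe ℕ
  candidateAt J s c = trackAt k (J ⊖ proj₁ c , prefix) (s + eval k J)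

  candidate-column : ∀ J R cs s {v} → trackAt k (rangeTrack J R) (s + eval k J) ≡ just v →
    column k (rangeTrack J R ∷ candidateTracks J prefix cs) (s + eval k J) ≡ just v ∷ map (candidateAt J s) cs
  candidate-column J R cs s range≡ = cong₂ _∷_ range≡ (column-map k (λ c → (J ⊖ proj₁ c , prefix)) cs (s + eval k J))

  candidate-prefix : ∀ J c s {y} → T (proj₁ c ≤ˢ J) → candidateAt J s c ≡ just y → nth E (eval k (proj₁ c) + s) ≡ just y
  candidate-prefix J c s c≤J shows = trans (sym (candidateTrack-value k J (proj₁ c) prefix s c≤J)) shows

  candidate-letter : ∀ J c s {y} → T (proj₁ c ≤ˢ J) → candidateAt J s c ≡ just y → G (eval k (proj₁ c) + s) ≡ y
  candidate-letter J c s c≤J shows = G-from-prefix _ (candidate-prefix J c s c≤J shows)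

  candidate-inside : ∀ J c s {y} → T (proj₁ c ≤ˢ J) → candidateAt J s c ≡ just y → eval k (proj₁ c) < length E
  candidate-inside J c s c≤J shows = ≤-<-trans (m≤m+n _ s) (nth-bound E _ (candidate-prefix J c s c≤J shows))

  break-at : ∀ q → 1 ≤ q → q < p → ∃ λ c → n₀ ≤ c × G (c + q) ≢ G c
  break-at q 1≤q q<p = from-mismatch (or-zipWith mismatches (candidateAt breakBase q) breaks checked)
    where
    range : ∃ λ v → trackAt k (rangeTrack breakBase period) (q + eval k breakBase) ≡ just v
    range = rangeTrack-defined k breakBase period q period-positive 1≤q q<p
    checked : T (someMismatch breaks (just (proj₁ range) ∷ map (candidateAt breakBase q) breaks))
    checked = verify-exact breaks-found k (q + eval k breakBase) (candidate-column breakBase period breaks q (proj₂ range))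
    from-mismatch : (∃ λ c → c ∈ breaks × T (mismatches (candidateAt breakBase q c) c)) → ∃ λ c → n₀ ≤ c × G (c + q) ≢ G c
    from-mismatch (c , c∈ , mismatch) =
      eval k (proj₁ c) , ≤ˢ⇒≤ start (proj₁ c) (All.lookup breaks-late c∈) , differ (mismatches-sound _ c mismatch)
      where
      c≤J : T (proj₁ c ≤ˢ breakBase)
      c≤J = All.lookup breaks-below c∈
      differ : (∃ λ y → candidateAt breakBase q c ≡ just y × y ≢ proj₂ c) → G (eval k (proj₁ c) + q) ≢ G (eval k (proj₁ c))
      differ (y , shows , y≢) same = y≢ (begin
        y                          ≡⟨ sym (candidate-letter breakBase c q c≤J shows) ⟩
        G (eval k (proj₁ c) + q)   ≡⟨ same ⟩
        G (eval k (proj₁ c))       ≡⟨ candidate-value breaks breaks-values c∈ (candidate-inside breakBase c q c≤J shows) ⟩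
        proj₂ c                    ∎)
        where open ≡-Reasoning

  minimal : ∀ q → 0 < q → EventuallyPeriodic G q → p ≤ q
  minimal q q>0 eventually with q <? p
  ... | no q≮p = ≮⇒≥ q≮p
  ... | yes q<p = refuted (break-at q q>0 q<p)
    where
    refuted : (∃ λ c → n₀ ≤ c × G (c + q) ≢ G c) → p ≤ q
    refuted (c , n₀≤c , differ) = ⊥-elim (not-eventual-period n₀≤c differ eventually)

  ultimately-periodic : UltPeriodic G p W
  ultimately-periodic = p>0 , length-W , (n₀ , periodic) , minimal ,
    (n₀ , λ q i i<p → trans (cong just (periodic-offset q i)) (sym (cycle-letter i i<p)))

  differs-on-prefix : ∀ {t} → t ∈ expansion → ∀ n → n + eval k t < length E → G (n + eval k t) ≢ G n
  differs-on-prefix {t} t∈ n x<len same = not-both differ (≡⇒≡ᵇ _ _ same)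
    where
    x : ℕ
    x = n + eval k t
    delayedAt : SymLen → Maybe ℕ
    delayedAt t′ = trackAt k (t′ , prefix) x
    column≡ : column k (expansionTracks prefix expansion) x ≡ just (G x) ∷ map delayedAt expansion
    column≡ = cong₂ _∷_ (prefix-nim x x<len) (column-map k (λ t′ → (t′ , prefix)) expansion x)
    at-t : delayedAt t ≡ just (G n)
    at-t = trans (delayed-after′ (eval k t) E n) (prefix-nim n (≤-<-trans (m≤m+n n (eval k t)) x<len))
    differ : T (differsFrom (G x) (just (G n)))
    differ = subst (T ∘ differsFrom (G x)) at-t
      (All.lookup (All-map⁻ (all⁺ (differsFrom (G x)) _ (verify-exact expansion-differs k x column≡))) t∈)

  in-expansion : ∀ {t} → t ∈ expansion → ∀ n → G (n + eval k t) ≢ G n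
  in-expansion t∈ = unequal-from-range _ (length E) (n₀+p≤ (All.lookup expansion-covered t∈)) (differs-on-prefix t∈)

  expansion-below-start : ∀ {s} → s ∈ Tₖ → s < n₀
  expansion-below-start s∈ with ∈-map⁻ (eval k) s∈
  ... | t , t∈ , refl = subst (_≤ n₀) (trans (eval-⊕ k t (0 , 1)) (+-comm (eval k t) 1))
                                      (≤ˢ⇒≤ (t ⊕ (0 , 1)) start (All.lookup expansion-early t∈))

  repeat-below : ∀ s → 1 ≤ s → s < n₀ + p → ¬ s ∈ Tₖ → ∃ λ n → G (n + s) ≡ G n
  repeat-below s 1≤s s<B s∉T = conclude (verify-sound repeats-found k x (subst Live (sym column≡) tt))
    where
    x : ℕ
    x = s + eval k repeatBase
    tracks : List Track
    tracks = rangeTrack repeatBase (start ⊕ period) ∷ candidateTracks repeatBase prefix repeats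
    exceptions : List ℕ
    exceptions = map (eval k) (map (_⊕ repeatBase) expansion)
    range : ∃ λ v → trackAt k (rangeTrack repeatBase (start ⊕ period)) x ≡ just v
    range = rangeTrack-defined k repeatBase (start ⊕ period) s (positive-⊕ start period period-positive) 1≤s
                               (subst (s <_) (sym (eval-⊕ k start period)) s<B)
    column≡ : column k tracks x ≡ just (proj₁ range) ∷ map (candidateAt repeatBase s) repeats
    column≡ = candidate-column repeatBase (start ⊕ period) repeats s (proj₂ range)
    -- the exceptions of the verification sit at repeatBase + t, t in the expansion
    from-exception : x ∈ exceptions → s ∈ Tₖ
    from-exception e with ∈-map⁻ (eval k) e
    ... | t⊕J , t⊕J∈ , x≡ with ∈-map⁻ (_⊕ repeatBase) t⊕J∈
    ...   | t , t∈ , refl = subst (_∈ Tₖ) (+-cancelʳ-≡ (eval k repeatBase) (eval k t) s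
                                             (trans (sym (eval-⊕ k t repeatBase)) (sym x≡)))
                                          (∈-map⁺ (eval k) t∈)
    from-match : (∃ λ c → c ∈ repeats × T (matches (candidateAt repeatBase s c) c)) → ∃ λ n → G (n + s) ≡ G n
    from-match (c , c∈ , match) = eval k (proj₁ c) , (begin
      G (eval k (proj₁ c) + s)   ≡⟨ candidate-letter repeatBase c s c≤J shows ⟩
      proj₂ c                    ≡⟨ sym (candidate-value repeats repeats-values c∈ (candidate-inside repeatBase c s c≤J shows)) ⟩
      G (eval k (proj₁ c))       ∎)
      where
      open ≡-Reasoning
      c≤J : T (proj₁ c ≤ˢ repeatBase)
      c≤J = All.lookup repeats-below c∈
      shows : candidateAt repeatBase s c ≡ just (proj₂ c)
      shows = matches-sound _ c match
    conclude : T (someMatch repeats (column k tracks x)) ⊎ x ∈ exceptions → ∃ λ n → G (n + s) ≡ G n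
    conclude (inj₁ found) = from-match (or-zipWith matches (candidateAt repeatBase s) repeats
                                          (subst (T ∘ someMatch repeats) column≡ found))
    conclude (inj₂ e) = ⊥-elim (s∉T (from-exception e))

  repeat : ∀ s → 1 ≤ s → ¬ s ∈ Tₖ → ∃ λ n → G (n + s) ≡ G n
  repeat s 1≤s s∉T with s <? n₀
  ... | yes s<n₀ = repeat-below s 1≤s (≤-trans s<n₀ (m≤m+n n₀ p)) s∉T
  ... | no s≮n₀ = equal-from-range inRange s (≮⇒≥ s≮n₀)
    where
    inRange : ∀ s′ → n₀ ≤ s′ → s′ < n₀ + p → ∃ λ n → G (n + s′) ≡ G n
    inRange s′ n₀≤s′ s′<B = repeat-below s′ (≤-trans (positive {start} start-positive) n₀≤s′) s′<B
                                         (λ s′∈ → <⇒≱ (expansion-below-start s′∈) n₀≤s′)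

  expansion-exact : HasExpansion G (_∈ Tₖ)
  expansion-exact s = mk⇔ to-expansion from-expansion
    where
    to-expansion : InExpansion G s → s ∈ Tₖ
    to-expansion (1≤s , differ) with s ∈? Tₖ
    ... | yes s∈T = s∈T
    ... | no s∉T = ⊥-elim (uncurry differ (repeat s 1≤s s∉T))
    from-expansion : s ∈ Tₖ → InExpansion G s
    from-expansion s∈T with ∈-map⁻ (eval k) s∈T
    ... | t , t∈ , refl = positive {t} (All.lookup expansion-positive t∈) , in-expansion t∈

-- The certificate for r = 2k + 5, i.e. a = r + 3 = 2k + 8.
oddFamily : Certificate
oddFamily = record
  { moves = (0 , 1) ∷ (1 , 8) ∷ (4 , 29) ∷ []
  ; maxMove = 4 , 29
  ; prefix = alt (1 , 8) ∷ letter 2 ∷ alt (1 , 8) ∷ letter 2 ∷ alt (1 , 8) ∷ letter 2 ∷ alt (1 , 2) ∷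
      letter 2 ∷ letter 3 ∷ letter 2 ∷ letter 3 ∷ letter 2 ∷ alt (1 , 4) ∷ letter 2 ∷ alt (1 , 8) ∷
      letter 2 ∷ alt (1 , 8) ∷ letter 2 ∷ alt (1 , 6) ∷ letter 2 ∷ alt (1 , 4) ∷ letter 2 ∷ letter 3 ∷
      letter 2 ∷ alt (1 , 6) ∷ letter 2 ∷ alt (1 , 8) ∷ letter 2 ∷ alt (1 , 6) ∷ letter 2 ∷
      alt (1 , 6) ∷ letter 2 ∷ alt (1 , 6) ∷ letter 2 ∷ alt (1 , 8) ∷ letter 2 ∷ alt (1 , 6) ∷
      letter 2 ∷ alt (1 , 6) ∷ letter 2 ∷ alt (1 , 6) ∷ letter 2 ∷ alt (1 , 8) ∷ letter 2 ∷
      alt (1 , 6) ∷ letter 2 ∷ alt (1 , 6) ∷ letter 2 ∷ alt (1 , 6) ∷ letter 2 ∷ alt (1 , 8) ∷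
      letter 2 ∷ alt (1 , 6) ∷ letter 2 ∷ alt (1 , 6) ∷ letter 2 ∷ alt (1 , 6) ∷ letter 2 ∷
      alt (1 , 8) ∷ letter 2 ∷ alt (1 , 6) ∷ letter 2 ∷ alt (1 , 6) ∷ letter 2 ∷ alt (1 , 6) ∷
      letter 2 ∷ alt (1 , 8) ∷ letter 2 ∷ alt (1 , 6) ∷ letter 2 ∷ alt (1 , 6) ∷ letter 2 ∷
      alt (1 , 6) ∷ letter 2 ∷ alt (1 , 8) ∷ letter 2 ∷ alt (1 , 6) ∷ letter 2 ∷ alt (1 , 6) ∷
      letter 2 ∷ alt (1 , 6) ∷ letter 2 ∷ alt (1 , 8) ∷ letter 2 ∷ alt (1 , 6) ∷ letter 2 ∷
      alt (1 , 6) ∷ letter 2 ∷ alt (1 , 6) ∷ letter 2 ∷ alt (1 , 8) ∷ letter 2 ∷ []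
  ; start = 11 , 87
  ; period = 4 , 30
  ; cycle = alt (1 , 6) ∷ letter 2 ∷ alt (1 , 6) ∷ letter 2 ∷ alt (1 , 6) ∷ letter 2 ∷ alt (1 , 8) ∷ letter 2 ∷ []
  ; expansion = (0 , 1) ∷ (1 , 8) ∷ (4 , 29) ∷ (4 , 31) ∷ (5 , 38) ∷ (9 , 68) ∷ []
  ; repeatBase = 11 , 84
  ; repeats = ((9 , 71) , 0) ∷ ((11 , 84) , 0) ∷ ((0 , 0) , 0) ∷ []
  ; breakBase = 15 , 116
  ; breaks = ((12 , 93) , 2) ∷ ((14 , 108) , 0) ∷ ((15 , 116) , 2) ∷ []
  ; moves-positive = tt ∷ tt ∷ tt ∷ []
  ; moves-bounded = tt ∷ tt ∷ tt ∷ []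
  ; period-positive = tt
  ; start-positive = tt
  ; cycle-length = refl
  ; prefix-long = tt
  ; expansion-positive = tt ∷ tt ∷ tt ∷ tt ∷ tt ∷ tt ∷ []
  ; expansion-early = tt ∷ tt ∷ tt ∷ tt ∷ tt ∷ tt ∷ []
  ; expansion-covered = tt ∷ tt ∷ tt ∷ tt ∷ tt ∷ tt ∷ []
  ; repeats-below = tt ∷ tt ∷ tt ∷ []
  ; breaks-below = tt ∷ tt ∷ tt ∷ []
  ; breaks-late = tt ∷ tt ∷ tt ∷ []
  ; prefix-is-nim = by-sweep 1000 refl
  ; prefix-periodic = by-sweep 1000 refl
  ; cycle-agrees = by-sweep 1000 refl
  ; expansion-differs = by-sweep 1000 refl
  ; repeats-found = by-sweep 1000 refl
  ; breaks-found = by-sweep 1000 refl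
  ; repeats-values = by-sweep 1000 refl
  ; breaks-values = by-sweep 1000 refl
  }

smallCase : Certificate
smallCase = record
  { moves = (0 , 1) ∷ (0 , 6) ∷ (0 , 21) ∷ []
  ; maxMove = 0 , 21
  ; prefix = alt (0 , 6) ∷ letter 2 ∷ alt (0 , 6) ∷ letter 2 ∷ alt (0 , 6) ∷ letter 2 ∷ letter 3 ∷
      letter 2 ∷ letter 3 ∷ letter 2 ∷ letter 3 ∷ alt (0 , 2) ∷ letter 3 ∷ alt (0 , 6) ∷ letter 2 ∷
      alt (0 , 6) ∷ letter 2 ∷ alt (0 , 4) ∷ letter 2 ∷ alt (0 , 2) ∷ letter 2 ∷ letter 3 ∷ letter 2 ∷
      alt (0 , 4) ∷ letter 2 ∷ alt (0 , 6) ∷ letter 2 ∷ alt (0 , 4) ∷ letter 2 ∷ alt (0 , 4) ∷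
      letter 2 ∷ alt (0 , 4) ∷ letter 2 ∷ alt (0 , 6) ∷ letter 2 ∷ alt (0 , 4) ∷ letter 2 ∷
      alt (0 , 4) ∷ letter 2 ∷ alt (0 , 4) ∷ letter 2 ∷ alt (0 , 6) ∷ letter 2 ∷ alt (0 , 4) ∷
      letter 2 ∷ alt (0 , 4) ∷ letter 2 ∷ alt (0 , 4) ∷ letter 2 ∷ alt (0 , 6) ∷ letter 2 ∷
      alt (0 , 4) ∷ letter 2 ∷ alt (0 , 4) ∷ letter 2 ∷ alt (0 , 4) ∷ letter 2 ∷ alt (0 , 6) ∷
      letter 2 ∷ alt (0 , 4) ∷ letter 2 ∷ alt (0 , 4) ∷ letter 2 ∷ alt (0 , 4) ∷ letter 2 ∷
      alt (0 , 6) ∷ letter 2 ∷ alt (0 , 4) ∷ letter 2 ∷ alt (0 , 4) ∷ letter 2 ∷ alt (0 , 4) ∷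
      letter 2 ∷ alt (0 , 6) ∷ letter 2 ∷ alt (0 , 3) ∷ []
  ; start = 0 , 65
  ; period = 0 , 22
  ; cycle = alt (0 , 4) ∷ letter 2 ∷ alt (0 , 4) ∷ letter 2 ∷ alt (0 , 4) ∷ letter 2 ∷ alt (0 , 6) ∷ letter 2 ∷ []
  ; expansion = (0 , 1) ∷ (0 , 6) ∷ (0 , 21) ∷ []
  ; repeatBase = 0 , 53
  ; repeats = ((0 , 53) , 0) ∷ ((0 , 40) , 0) ∷ ((0 , 0) , 0) ∷ ((0 , 24) , 2) ∷ ((0 , 4) , 0) ∷ []
  ; breakBase = 0 , 84
  ; breaks = ((0 , 69) , 2) ∷ ((0 , 79) , 2) ∷ ((0 , 84) , 0) ∷ []
  ; moves-positive = tt ∷ tt ∷ tt ∷ []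
  ; moves-bounded = tt ∷ tt ∷ tt ∷ []
  ; period-positive = tt
  ; start-positive = tt
  ; cycle-length = refl
  ; prefix-long = tt
  ; expansion-positive = tt ∷ tt ∷ tt ∷ []
  ; expansion-early = tt ∷ tt ∷ tt ∷ []
  ; expansion-covered = tt ∷ tt ∷ tt ∷ []
  ; repeats-below = tt ∷ tt ∷ tt ∷ tt ∷ tt ∷ []
  ; breaks-below = tt ∷ tt ∷ tt ∷ []
  ; breaks-late = tt ∷ tt ∷ tt ∷ []
  ; prefix-is-nim = by-sweep 1000 refl
  ; prefix-periodic = by-sweep 1000 refl
  ; cycle-agrees = by-sweep 1000 refl
  ; expansion-differs = by-sweep 1000 refl
  ; repeats-found = by-sweep 1000 refl
  ; breaks-found = by-sweep 1000 refl
  ; repeats-values = by-sweep 1000 refl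
  ; breaks-values = by-sweep 1000 refl
  }

Conclusion : ℕ → List ℕ → ℕ → List ℕ → List ℕ → Set
Conclusion r S p W T =
  UltPeriodic (grundy S) p W × (r ≡ 3 → NonExpandable S p) × (r ≢ 3 → HasExpansion (grundy S) (_∈ T))

conclusion-cong : ∀ {r S S′ p p′ W W′ T T′} → S ≡ S′ → p ≡ p′ → W ≡ W′ → T ≡ T′ →
  Conclusion r S p W T → Conclusion r S′ p′ W′ T′
conclusion-cong refl refl refl refl c = c

odd-cases : ∀ r → 3 ≤ r → r % 2 ≡ 1 → r ≡ 3 ⊎ ∃ λ k → r ≡ 5 + 2 * k
odd-cases r r≥3 odd = by-half (r / 2) (trans (m≡m%n+[m/n]*n r 2) (cong (_+ (r / 2) * 2) odd))
  where
  by-half : ∀ h → r ≡ 1 + h * 2 → r ≡ 3 ⊎ ∃ λ k → r ≡ 5 + 2 * k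
  by-half zero r≡1 = ⊥-elim (<⇒≱ (s≤s (s≤s z≤n)) (subst (3 ≤_) r≡1 r≥3))
  by-half (suc zero) r≡3 = inj₁ r≡3
  by-half (suc (suc k)) r≡ = inj₂ (k , trans r≡ (rearrange k))
    where
    rearrange : ∀ k → 1 + suc (suc k) * 2 ≡ 5 + 2 * k
    rearrange = solve-∀

Claim : ℕ → Set
Claim r = Conclusion r (1 ∷ (r + 3) ∷ (3 * (r + 3) + r) ∷ []) (4 * (r + 3) ∸ 2) (word (r + 3))
  (1 ∷ (r + 3) ∷ (4 * (r + 3) ∸ 3) ∷ (4 * (r + 3) ∸ 1) ∷ (5 * (r + 3) ∸ 2) ∷ (9 * (r + 3) ∸ 4) ∷ [])

case-r≡3 : Claim 3
case-r≡3 = ultimately-periodic , (λ _ → inj₁ expansion-exact) , (λ r≢3 → ⊥-elim (r≢3 refl))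
  where open Consequences smallCase 0

alternating-shift : ∀ i n → alternating (suc (suc i)) n ≡ alternating i n
alternating-shift i zero = refl
alternating-shift i (suc n) = cong (parity i ∷_) (alternating-shift (suc i) n)

alternating-pairs : ∀ m → alternating 0 (m + m) ≡ rep m (0 ∷ 1 ∷ [])
alternating-pairs zero = refl
alternating-pairs (suc m) rewrite +-suc m m =
  cong (λ w → 0 ∷ 1 ∷ w) (trans (alternating-shift 0 (m + m)) (alternating-pairs m))

word-layout : ∀ a h → a / 2 ≡ suc h →
  word a ≡ rep h (0 ∷ 1 ∷ []) ++ 2 ∷ (rep h (0 ∷ 1 ∷ []) ++ 2 ∷ (rep h (0 ∷ 1 ∷ []) ++ 2 ∷ (rep (suc h) (0 ∷ 1 ∷ []) ++ 2 ∷ [])))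
word-layout a h half = begin
  word a                                   ≡⟨ cong (λ m → rep 3 (rep (m ∸ 1) P ++ 2 ∷ []) ++ rep m P ++ 2 ∷ []) half ⟩
  rep 3 X ++ V                             ≡⟨ ++-assoc X (rep 2 X) V ⟩
  X ++ (rep 2 X ++ V)                      ≡⟨ cong (X ++_) (++-assoc X (rep 1 X) V) ⟩
  X ++ (X ++ (rep 1 X ++ V))               ≡⟨ cong (λ w → X ++ (X ++ w)) (++-assoc X [] V) ⟩
  X ++ (X ++ (X ++ V))                     ≡⟨ closed (X ++ (X ++ V)) ⟩
  x ++ 2 ∷ (X ++ (X ++ V))                 ≡⟨ cong (λ w → x ++ 2 ∷ w) (closed (X ++ V)) ⟩
  x ++ 2 ∷ (x ++ 2 ∷ (X ++ V))             ≡⟨ cong (λ w → x ++ 2 ∷ (x ++ 2 ∷ w)) (closed V) ⟩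
  x ++ 2 ∷ (x ++ 2 ∷ (x ++ 2 ∷ V))         ∎
  where
  open ≡-Reasoning
  P x X V : List ℕ
  P = 0 ∷ 1 ∷ []
  x = rep h P
  X = x ++ 2 ∷ []
  V = rep (suc h) P ++ 2 ∷ []
  closed : ∀ w → X ++ w ≡ x ++ 2 ∷ w
  closed w = ++-assoc x (2 ∷ []) w

module OddFamily (k : ℕ) where
  r : ℕ
  r = 5 + 2 * k

  cycle≡ : decode k (Certificate.cycle oddFamily) ≡ word (r + 3)
  cycle≡ = sym (trans (word-layout (r + 3) (3 + k) half)
                      (cong₂ (λ x y → x ++ 2 ∷ (x ++ 2 ∷ (x ++ 2 ∷ (y ++ 2 ∷ []))))
                             (sym (alternating-length (3 + k) (halves₆ k))) (sym (alternating-length (4 + k) (halves₈ k)))))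
    where
    double : ∀ k → (5 + 2 * k) + 3 ≡ (4 + k) * 2
    double = solve-∀
    half : (r + 3) / 2 ≡ 4 + k
    half = trans (cong (_/ 2) (double k)) (m*n/n≡m (4 + k) 2)
    halves₆ : ∀ k → 1 * (k + k) + 6 ≡ (3 + k) + (3 + k)
    halves₆ = solve-∀
    halves₈ : ∀ k → 1 * (k + k) + 8 ≡ (4 + k) + (4 + k)
    halves₈ = solve-∀
    alternating-length : ∀ m {n} → n ≡ m + m → alternating 0 n ≡ rep m (0 ∷ 1 ∷ [])
    alternating-length m n≡ = trans (cong (alternating 0) n≡) (alternating-pairs m)

  scaled : ∀ c d → d ≤ 8 * c → c * (r + 3) ∸ d ≡ eval k (c , 8 * c ∸ d)
  scaled c d d≤8c = trans (cong (_∸ d) (multiple c k)) (+-∸-assoc (c * (k + k)) d≤8c)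
    where
    multiple : ∀ c k → c * ((5 + 2 * k) + 3) ≡ c * (k + k) + 8 * c
    multiple = solve-∀

  a-value : ∀ k → 1 * (k + k) + 8 ≡ (5 + 2 * k) + 3
  a-value = solve-∀

  3a+r-value : ∀ k → 4 * (k + k) + 29 ≡ 3 * ((5 + 2 * k) + 3) + (5 + 2 * k)
  3a+r-value = solve-∀

  moves≡ : map (eval k) (Certificate.moves oddFamily) ≡ 1 ∷ (r + 3) ∷ (3 * (r + 3) + r) ∷ []
  moves≡ = cong (1 ∷_) (cong₂ _∷_ (a-value k) (cong (_∷ []) (3a+r-value k)))

  period≡ : eval k (Certificate.period oddFamily) ≡ 4 * (r + 3) ∸ 2
  period≡ = sym (scaled 4 2 (≤ᵇ⇒≤ 2 32 tt))

  expansion≡ : map (eval k) (Certificate.expansion oddFamily)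
    ≡ 1 ∷ (r + 3) ∷ (4 * (r + 3) ∸ 3) ∷ (4 * (r + 3) ∸ 1) ∷ (5 * (r + 3) ∸ 2) ∷ (9 * (r + 3) ∸ 4) ∷ []
  expansion≡ = cong (1 ∷_) (cong₂ _∷_ (a-value k) (cong₂ _∷_ (sym (scaled 4 3 (≤ᵇ⇒≤ 3 32 tt)))
                 (cong₂ _∷_ (sym (scaled 4 1 (≤ᵇ⇒≤ 1 32 tt))) (cong₂ _∷_ (sym (scaled 5 2 (≤ᵇ⇒≤ 2 40 tt)))
                 (cong (_∷ []) (sym (scaled 9 4 (≤ᵇ⇒≤ 4 72 tt))))))))

  claim : Claim r
  claim = conclusion-cong moves≡ period≡ cycle≡ expansion≡
            (ultimately-periodic , (λ ()) , λ _ → expansion-exact)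
    where open Consequences oddFamily k

theorem3p17 : ∀ (r : ℕ) → 3 ≤ r → r % 2 ≡ 1 →
    UltPeriodic (grundy (1 ∷ (r + 3) ∷ (3 * (r + 3) + r) ∷ [])) (4 * (r + 3) ∸ 2) (word (r + 3))
    × (r ≡ 3 → NonExpandable (1 ∷ (r + 3) ∷ (3 * (r + 3) + r) ∷ []) (4 * (r + 3) ∸ 2))
    × (r ≢ 3 → HasExpansion (grundy (1 ∷ (r + 3) ∷ (3 * (r + 3) + r) ∷ []))
         (_∈ (1 ∷ (r + 3) ∷ (4 * (r + 3) ∸ 3) ∷ (4 * (r + 3) ∸ 1) ∷ (5 * (r + 3) ∸ 2) ∷ (9 * (r + 3) ∸ 4) ∷ [])))
theorem3p17 r r≥3 odd with odd-cases r r≥3 odd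
... | inj₁ refl = case-r≡3
... | inj₂ (k , refl) = OddFamily.claim k
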